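{- Let $n\ge1$ be an integer and let $\mu$ be a composition (possibly empty) of length $\ell(\mu)$ and size $|\mu|$. (i) If $h(k)=1$ for all $k\ge1$, then $H(\mu,n)=\binom{n-|\mu|}{\ell(\mu)}$. (ii) If $h(k)=k$ for all $k\ge1$, then $$H(\mu,n)=\prod_{k=0}^{|\mu|+\ell(\mu)-1}(n-k)\;\prod_{k=1}^{\ell(\mu)}\Big(k+\sum_{j=1}^k\mu_j\Big)^{ -1}.$$
   Context: Let $h$ be an arithmetic function $\mathbb{N}\to\mathbb{C}$ with $h(1)=1$ and $h(k)\ne0$ for all $k$; put $h(0):=0$ and $h_m(n):=\prod_{k=0}^{m-1}h(n-k)$. A composition $\mu=(\mu_1,\dots,\mu_r)$ is a finite sequence of positive integers, $\ell(\mu)=r$, $|\mu|=\sum\mu_i$; the empty composition $\varepsilon$ has $\ell=|\cdot|=0$. Define $H(\mu,n)$ for integers $n\ge0$ by induction on length: $H(\varepsilon,n):=1$; if $\mu=(\mu_1,\dots,\mu_{r+1})$ then for $n\ge|\mu|+\ell(\mu)$, $H(\mu,n):=\sum_{k=|\mu|+\ell(\mu)-1}^{n-1}h_{\mu_{r+1}}(k)\,H((\mu_1,\dots,\mu_r),k-\mu_{r+1})$, and $H(\mu,n):=0$ if $n<|\mu|+\ell(\mu)$. Binomial coefficients $\binom{a}{b}$ with integer $a$ and integer $b\ge0$ are taken to be $0$ when $a<b$. -}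

module Defs where

open import Data.Nat using (ℕ; zero; suc; _+_; _*_; _∸_)
open import Data.List using (List; []; _∷_; map; upTo; reverse; length; foldr; take)
open import Data.Nat.ListAction using (sum; product)
open import Data.Integer as ℤ using (ℤ; +_)
open import Data.Rational as ℚ using (ℚ)

sumRange : ℕ → ℕ → (ℕ → ℕ) → ℕ
sumRange a b f = sum (map (λ i → f (a + i)) (upTo (b ∸ a)))

-- h extended by the convention h(0) := 0 (only the values h(k), k ≥ 1, are used).
hExt : (ℕ → ℕ) → ℕ → ℕ
hExt h zero    = 0
hExt h (suc k) = h (suc k)

-- h_m(n) = ∏_{k=0}^{m-1} h(n-k)   (arguments only ever ≥ 1 where used; ∸ is harmless)
hFall : (ℕ → ℕ) → ℕ → ℕ → ℕ
hFall h m n = product (map (λ k → hExt h (n ∸ k)) (upTo m))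

size : List ℕ → ℕ
size = sum

-- H on the REVERSED composition: HRev h (m ∷ ρ) n is H((reverse ρ) ++ [m], n),
-- i.e. the head of the list is the last part μ_{r+1}.
HRev : (ℕ → ℕ) → List ℕ → ℕ → ℕ
HRev h []      n = 1
HRev h (m ∷ ρ) n =
  sumRange (size (m ∷ ρ) + length (m ∷ ρ) ∸ 1) n
           (λ k → hFall h m k * HRev h ρ (k ∸ m))

H : (ℕ → ℕ) → List ℕ → ℕ → ℕ
H h μ n = HRev h (reverse μ) n

prodℤ : List ℤ → ℤ
prodℤ = foldr ℤ._*_ (+ 1)

prodℚ : List ℚ → ℚ
prodℚ = foldr ℚ._*_ ℚ.1ℚ

fallingℤ : ℕ → ℕ → ℤ
fallingℤ n N = prodℤ (map (λ k → + n ℤ.- + k) (upTo N))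

invPartialProd : List ℕ → ℚ
invPartialProd μ =
  prodℚ (map (λ i → (+ 1) ℚ./ (suc (i + sum (take (suc i) μ)))) (upTo (length μ)))

-- Removing the last part m of a composition gives the recursion
-- H(μ m, n) = Σ_{a ≤ k < n} h_m(k) H(μ, k − m) with a = |μ| + ℓ(μ) + m, so H(μ m, ·) is
-- the function vanishing on [0, a] whose increments at k ≥ a are these summands; by
-- induction on ℓ(μ) it suffices to check that the claimed closed form has the same
-- increments.  For h = 1 this is Pascal's rule for binomial coefficients; for h = id,
-- after multiplying by the denominator ∏ₖ (k + μ₁ + ⋯ + μₖ), it is Pascal's rule
-- (x + 1)↓(a + 1) = x↓(a + 1) + (a + 1) x↓a for falling factorials.
module Submission where

open import Defs
open import Data.Nat using (ℕ; zero; suc; _+_; _∸_; _≤_; _<_; z≤n; s≤s) renaming (_*_ to _·_)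
open import Data.Nat.Properties
open import Data.Nat.Combinatorics using (_C_; k>n⇒nCk≡0; nCk+nC[k+1]≡[n+1]C[k+1])
open import Data.Nat.ListAction using (sum; product)
open import Data.Nat.ListAction.Properties using (sum-++; product-++; sum-↭)
open import Data.List
  using (List; []; _∷_; _++_; _∷ʳ_; [_]; map; upTo; applyUpTo; reverse; take; length)
open import Data.List.Properties
  using ( map-++; map-cong; map-cong-local; map-upTo; upTo-∷ʳ; take-all
        ; length-++; length-reverse; unfold-reverse; reverse-involutive )
open import Data.List.Relation.Unary.All using (All; []; _∷_)
import Data.List.Relation.Unary.All.Properties as All
open import Data.List.Relation.Binary.Permutation.Propositional.Properties using (↭-reverse)
open import Data.Sum using (inj₁; inj₂)
open import Data.Product using (_×_; _,_)
open import Function using (id; _∘_)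
open import Relation.Binary.PropositionalEquality
  using (_≡_; refl; sym; trans; cong; cong₂; module ≡-Reasoning)
open import Data.Integer as ℤ using (ℤ; +_)
import Data.Integer.Properties as ℤ
open import Data.Rational using (ℚ; _/_; _*_; 1ℚ; toℚᵘ)
import Data.Rational.Properties as ℚ
import Data.Rational.Unnormalised as ℚᵘ
import Data.Rational.Unnormalised.Properties as ℚᵘ
open import Algebra.Bundles using (CommutativeMonoid)
open import Algebra.Properties.CommutativeSemigroup
  (CommutativeMonoid.commutativeSemigroup ℚ.*-1-commutativeMonoid) using (interchange)

open ≡-Reasoning

sum-map-*ʳ : ∀ {A : Set} (f : A → ℕ) c xs → sum (map f xs) · c ≡ sum (map (λ x → f x · c) xs)
sum-map-*ʳ f c []       = refl
sum-map-*ʳ f c (x ∷ xs) =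
  trans (*-distribʳ-+ c (f x) _) (cong (λ s → f x · c + s) (sum-map-*ʳ f c xs))

sumRange-*ʳ : ∀ a n F c → sumRange a n F · c ≡ sumRange a n (λ x → F x · c)
sumRange-*ʳ a n F c = sum-map-*ʳ (λ i → F (a + i)) c (upTo (n ∸ a))

sumRange-telescope : ∀ a n (F G : ℕ → ℕ) →
  (∀ x → x ≤ a → G x ≡ 0) → (∀ x → a ≤ x → G (suc x) ≡ G x + F x) →
  sumRange a n F ≡ G n
sumRange-telescope a n F G G-vanishes G-step with ≤-total a n
... | inj₁ a≤n = trans (partial (n ∸ a)) (cong G (m+[n∸m]≡n a≤n))
  where
  f : ℕ → ℕ
  f i = F (a + i)
  partial : ∀ N → sum (map f (upTo N)) ≡ G (a + N)
  partial zero    = sym (G-vanishes (a + 0) (≤-reflexive (+-identityʳ a)))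
  partial (suc N) = begin
    sum (map f (upTo (suc N)))         ≡⟨ cong (sum ∘ map f) (upTo-∷ʳ N) ⟨
    sum (map f (upTo N ∷ʳ N))          ≡⟨ cong sum (map-++ f (upTo N) [ N ]) ⟩
    sum (map f (upTo N) ++ [ f N ])    ≡⟨ sum-++ (map f (upTo N)) [ f N ] ⟩
    sum (map f (upTo N)) + (f N + 0)   ≡⟨ cong₂ _+_ (partial N) (+-identityʳ (f N)) ⟩
    G (a + N) + F (a + N)              ≡⟨ G-step (a + N) (m≤m+n a N) ⟨
    G (suc (a + N))                    ≡⟨ cong G (+-suc a N) ⟨
    G (a + suc N)                      ∎
... | inj₂ n≤a = begin
  sumRange a n F  ≡⟨ cong (λ N → sum (map (λ i → F (a + i)) (upTo N))) (m≤n⇒m∸n≡0 n≤a) ⟩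
  0               ≡⟨ G-vanishes n n≤a ⟨
  G n             ∎

falling : ℕ → ℕ → ℕ
falling n       zero    = 1
falling zero    (suc k) = 0
falling (suc n) (suc k) = suc n · falling n k

falling-vanishes : ∀ {n k} → n < k → falling n k ≡ 0
falling-vanishes {zero}  {suc k} _         = refl
falling-vanishes {suc n} {suc k} (s≤s n<k) =
  trans (cong (suc n ·_) (falling-vanishes n<k)) (*-zeroʳ (suc n))

falling-suc : ∀ n k → falling n (suc k) ≡ falling n k · (n ∸ k)
falling-suc zero    zero    = refl
falling-suc zero    (suc k) = refl
falling-suc (suc n) zero    = *-comm (suc n) 1
falling-suc (suc n) (suc k) =
  trans (cong (suc n ·_) (falling-suc n k)) (sym (*-assoc (suc n) (falling n k) (n ∸ k)))

falling-*-falling : ∀ n k j → falling n k · falling (n ∸ k) j ≡ falling n (k + j)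
falling-*-falling n       zero    j = *-identityˡ (falling n j)
falling-*-falling zero    (suc k) j = refl
falling-*-falling (suc n) (suc k) j =
  trans (*-assoc (suc n) (falling n k) _) (cong (suc n ·_) (falling-*-falling n k j))

falling-pascal : ∀ {n k} → k ≤ n →
  falling (suc n) (suc k) ≡ falling n (suc k) + suc k · falling n k
falling-pascal {n} {k} k≤n = sym (begin
  falling n (suc k) + suc k · x  ≡⟨ cong (_+ suc k · x) (falling-suc n k) ⟩
  x · (n ∸ k) + suc k · x        ≡⟨ cong (_+ suc k · x) (*-comm x (n ∸ k)) ⟩
  (n ∸ k) · x + suc k · x        ≡⟨ *-distribʳ-+ x (n ∸ k) (suc k) ⟨
  ((n ∸ k) + suc k) · x          ≡⟨ cong (_· x) (trans (+-suc (n ∸ k) k) (cong suc (m∸n+n≡m k≤n))) ⟩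
  suc n · x                      ∎)
  where
  x = falling n k

product-applyUpTo-∸ : ∀ n k → product (applyUpTo (n ∸_) k) ≡ falling n k
product-applyUpTo-∸ n       zero    = refl
product-applyUpTo-∸ zero    (suc k) = refl
product-applyUpTo-∸ (suc n) (suc k) = cong (suc n ·_) (product-applyUpTo-∸ n k)

sum-reverse : ∀ xs → sum (reverse xs) ≡ sum xs
sum-reverse xs = sum-↭ (↭-reverse xs)

take-++ˡ : ∀ {A : Set} k (xs ys : List A) → k ≤ length xs → take k (xs ++ ys) ≡ take k xs
take-++ˡ zero    xs       ys _         = refl
take-++ˡ (suc k) (x ∷ xs) ys (s≤s k≤l) = cong (x ∷_) (take-++ˡ k xs ys k≤l)

length-∷ʳ : ∀ {A : Set} (xs : List A) x → length (xs ∷ʳ x) ≡ suc (length xs)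
length-∷ʳ xs x = trans (length-++ xs) (+-comm (length xs) 1)

weights : List ℕ → List ℕ
weights μ = map (λ i → suc (i + sum (take (suc i) μ))) (upTo (length μ))

denominator : List ℕ → ℕ
denominator μ = product (weights μ)

weights-∷ʳ : ∀ μ m → weights (μ ∷ʳ m) ≡ weights μ ∷ʳ suc (length μ + sum (μ ∷ʳ m))
weights-∷ʳ μ m = begin
  map w′ (upTo (length (μ ∷ʳ m)))  ≡⟨ cong (map w′ ∘ upTo) (length-∷ʳ μ m) ⟩
  map w′ (upTo (suc l))            ≡⟨ cong (map w′) (upTo-∷ʳ l) ⟨
  map w′ (upTo l ∷ʳ l)             ≡⟨ map-++ w′ (upTo l) [ l ] ⟩
  map w′ (upTo l) ∷ʳ w′ l          ≡⟨ cong₂ _∷ʳ_ prefix last ⟩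
  weights μ ∷ʳ suc (l + sum (μ ∷ʳ m)) ∎
  where
  l = length μ
  w′ : ℕ → ℕ
  w′ i = suc (i + sum (take (suc i) (μ ∷ʳ m)))
  prefix : map w′ (upTo l) ≡ weights μ
  prefix = map-cong-local (All.applyUpTo⁺₁ id l
    (λ {i} i<l → cong (λ ys → suc (i + sum ys)) (take-++ˡ (suc i) μ [ m ] i<l)))
  last : w′ l ≡ suc (l + sum (μ ∷ʳ m))
  last = cong (λ ys → suc (l + sum ys))
              (take-all (suc l) (μ ∷ʳ m) (≤-reflexive (length-∷ʳ μ m)))

denominator-reverse-∷ : ∀ m ρ →
  denominator (reverse (m ∷ ρ)) ≡ denominator (reverse ρ) · suc (m + sum ρ + length ρ)
denominator-reverse-∷ m ρ = begin
  product (weights (reverse (m ∷ ρ)))       ≡⟨ cong (product ∘ weights) (unfold-reverse m ρ) ⟩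
  product (weights (μ ∷ʳ m))                ≡⟨ cong product (weights-∷ʳ μ m) ⟩
  product (weights μ ∷ʳ w)                  ≡⟨ product-++ (weights μ) [ w ] ⟩
  denominator μ · (w · 1)                   ≡⟨ cong (λ x → denominator μ · suc x) last ⟩
  denominator μ · suc (m + sum ρ + length ρ) ∎
  where
  μ = reverse ρ
  w = suc (length μ + sum (μ ∷ʳ m))
  last : (length μ + sum (μ ∷ʳ m)) · 1 ≡ m + sum ρ + length ρ
  last = begin
    (length μ + sum (μ ∷ʳ m)) · 1       ≡⟨ *-identityʳ _ ⟩
    length μ + sum (μ ∷ʳ m)             ≡⟨ cong₂ _+_ (length-reverse ρ) sum-μ∷ʳm ⟩
    length ρ + (m + sum ρ)              ≡⟨ +-comm (length ρ) (m + sum ρ) ⟩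
    m + sum ρ + length ρ                ∎
    where
    sum-μ∷ʳm : sum (μ ∷ʳ m) ≡ m + sum ρ
    sum-μ∷ʳm = trans (cong sum (sym (unfold-reverse m ρ))) (sum-reverse (m ∷ ρ))

product-ones : ∀ {xs} → All (_≡ 1) xs → product xs ≡ 1
product-ones []           = refl
product-ones (refl ∷ ps) = trans (+-identityʳ _) (product-ones ps)

hFall-const : ∀ h → (∀ k → 1 ≤ k → h k ≡ 1) → ∀ {m x} → m ≤ x → hFall h m x ≡ 1
hFall-const h h≡1 {m} {x} m≤x = product-ones (All.map⁺ (All.applyUpTo⁺₁ id m factor≡1))
  where
  factor≡1 : ∀ {j} → j < m → hExt h (x ∸ j) ≡ 1
  factor≡1 {j} j<m with x ∸ j | m<n⇒0<n∸m (≤-trans j<m m≤x)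
  ... | suc y | 0<x∸j = h≡1 (suc y) 0<x∸j

hFall-id : ∀ h → (∀ k → 1 ≤ k → h k ≡ k) → ∀ m x → hFall h m x ≡ falling x m
hFall-id h h≡id m x = begin
  product (map (λ j → hExt h (x ∸ j)) (upTo m))  ≡⟨ cong product (map-cong (hExt≡id ∘ (x ∸_)) (upTo m)) ⟩
  product (map (x ∸_) (upTo m))                  ≡⟨ cong product (map-upTo (x ∸_) m) ⟩
  product (applyUpTo (x ∸_) m)                   ≡⟨ product-applyUpTo-∸ x m ⟩
  falling x m                                    ∎
  where
  hExt≡id : ∀ k → hExt h k ≡ k
  hExt≡id zero    = refl
  hExt≡id (suc k) = h≡id (suc k) (s≤s z≤n)

HRev-∷ : ∀ h m ρ n →
  HRev h (m ∷ ρ) n ≡ sumRange (m + sum ρ + length ρ) n (λ k → hFall h m k · HRev h ρ (k ∸ m))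
HRev-∷ h m ρ n = cong (λ a → sumRange a n (λ k → hFall h m k · HRev h ρ (k ∸ m)))
                      (cong (_∸ 1) (+-suc (m + sum ρ) (length ρ)))

HRev≡binomial : ∀ h → (∀ k → 1 ≤ k → h k ≡ 1) → ∀ ρ n → HRev h ρ n ≡ (n ∸ sum ρ) C length ρ
HRev≡binomial h h≡1 []      n = refl
HRev≡binomial h h≡1 (m ∷ ρ) n =
  trans (HRev-∷ h m ρ n) (sumRange-telescope a n _ G G-vanishes G-step)
  where
  s = sum ρ
  l = length ρ
  a = m + s + l
  G : ℕ → ℕ
  G x = (x ∸ (m + s)) C suc l
  G-vanishes : ∀ x → x ≤ a → G x ≡ 0
  G-vanishes x x≤a =
    k>n⇒nCk≡0 (s≤s (≤-trans (∸-monoˡ-≤ (m + s) x≤a) (≤-reflexive (m+n∸m≡n (m + s) l))))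
  G-step : ∀ x → a ≤ x → G (suc x) ≡ G x + hFall h m x · HRev h ρ (x ∸ m)
  G-step x a≤x = begin
    (suc x ∸ (m + s)) C suc l    ≡⟨ cong (_C suc l) (+-∸-assoc 1 m+s≤x) ⟩
    suc y C suc l                ≡⟨ nCk+nC[k+1]≡[n+1]C[k+1] y l ⟨
    y C l + y C suc l            ≡⟨ +-comm (y C l) (y C suc l) ⟩
    y C suc l + y C l            ≡⟨ cong (λ t → G x + t) summand ⟨
    G x + hFall h m x · HRev h ρ (x ∸ m) ∎
    where
    m+s≤x = ≤-trans (m≤m+n (m + s) l) a≤x
    y = x ∸ (m + s)
    summand : hFall h m x · HRev h ρ (x ∸ m) ≡ y C l
    summand = begin
      hFall h m x · HRev h ρ (x ∸ m)
        ≡⟨ cong₂ _·_ (hFall-const h h≡1 (≤-trans (m≤m+n m s) m+s≤x))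
                     (HRev≡binomial h h≡1 ρ (x ∸ m)) ⟩
      1 · ((x ∸ m ∸ s) C l)
        ≡⟨ trans (*-identityˡ _) (cong (_C l) (∸-+-assoc x m s)) ⟩
      y C l ∎

HRev·denominator≡falling : ∀ h → (∀ k → 1 ≤ k → h k ≡ k) → ∀ ρ n →
  HRev h ρ n · denominator (reverse ρ) ≡ falling n (sum ρ + length ρ)
HRev·denominator≡falling h h≡id []      n = refl
HRev·denominator≡falling h h≡id (m ∷ ρ) n = begin
  HRev h (m ∷ ρ) n · denominator (reverse (m ∷ ρ))
    ≡⟨ cong₂ _·_ (HRev-∷ h m ρ n) (denominator-reverse-∷ m ρ) ⟩
  sumRange a n F · (D · suc a)
    ≡⟨ sumRange-*ʳ a n F (D · suc a) ⟩
  sumRange a n (λ x → F x · (D · suc a))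
    ≡⟨ sumRange-telescope a n _ (λ x → falling x (suc a)) G-vanishes G-step ⟩
  falling n (suc a)
    ≡⟨ cong (falling n) (+-suc (m + s) l) ⟨
  falling n (m + s + suc l) ∎
  where
  s = sum ρ
  l = length ρ
  a = m + s + l
  D = denominator (reverse ρ)
  F : ℕ → ℕ
  F x = hFall h m x · HRev h ρ (x ∸ m)
  G-vanishes : ∀ x → x ≤ a → falling x (suc a) ≡ 0
  G-vanishes x x≤a = falling-vanishes (s≤s x≤a)
  summand : ∀ x → F x · (D · suc a) ≡ suc a · falling x a
  summand x = begin
    (u · v) · (D · suc a)                            ≡⟨ *-assoc (u · v) D (suc a) ⟨
    ((u · v) · D) · suc a                            ≡⟨ cong (_· suc a) (*-assoc u v D) ⟩
    (u · (v · D)) · suc a                            ≡⟨ cong₂ (λ p q → (p · q) · suc a) u≡ v·D≡ ⟩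
    (falling x m · falling (x ∸ m) (s + l)) · suc a  ≡⟨ cong (_· suc a) (falling-*-falling x m (s + l)) ⟩
    falling x (m + (s + l)) · suc a                  ≡⟨ cong (λ k → falling x k · suc a) (+-assoc m s l) ⟨
    falling x a · suc a                              ≡⟨ *-comm (falling x a) (suc a) ⟩
    suc a · falling x a                              ∎
    where
    u = hFall h m x
    v = HRev h ρ (x ∸ m)
    u≡ : u ≡ falling x m
    u≡ = hFall-id h h≡id m x
    v·D≡ : v · D ≡ falling (x ∸ m) (s + l)
    v·D≡ = HRev·denominator≡falling h h≡id ρ (x ∸ m)
  G-step : ∀ x → a ≤ x → falling (suc x) (suc a) ≡ falling x (suc a) + F x · (D · suc a)
  G-step x a≤x = trans (falling-pascal a≤x) (cong (λ t → falling x (suc a) + t) (sym (summand x)))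

H≡binomial : ∀ h → (∀ k → 1 ≤ k → h k ≡ 1) → ∀ μ n → H h μ n ≡ (n ∸ sum μ) C length μ
H≡binomial h h≡1 μ n = trans (HRev≡binomial h h≡1 (reverse μ) n)
                             (cong₂ (λ s l → (n ∸ s) C l) (sum-reverse μ) (length-reverse μ))

H·denominator≡falling : ∀ h → (∀ k → 1 ≤ k → h k ≡ k) → ∀ μ n →
  H h μ n · denominator μ ≡ falling n (sum μ + length μ)
H·denominator≡falling h h≡id μ n = begin
  H h μ n · denominator μ
    ≡⟨ cong (λ ν → H h μ n · denominator ν) (reverse-involutive μ) ⟨
  H h μ n · denominator (reverse (reverse μ))
    ≡⟨ HRev·denominator≡falling h h≡id (reverse μ) n ⟩
  falling n (sum (reverse μ) + length (reverse μ))
    ≡⟨ cong₂ (λ s l → falling n (s + l)) (sum-reverse μ) (length-reverse μ) ⟩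
  falling n (sum μ + length μ) ∎

fromℕ : ℕ → ℚ
fromℕ k = (+ k) / 1

toℚᵘ-fromℕ : ∀ k → toℚᵘ (fromℕ k) ℚᵘ.≃ ℚᵘ.mkℚᵘ (+ k) 0
toℚᵘ-fromℕ k = ℚ.toℚᵘ-fromℚᵘ (ℚᵘ.mkℚᵘ (+ k) 0)

fromℕ-· : ∀ a b → fromℕ (a · b) ≡ fromℕ a * fromℕ b
fromℕ-· a b = ℚ.toℚᵘ-injective (ℚᵘ.≃-trans (toℚᵘ-fromℕ (a · b))
  (ℚᵘ.≃-trans (ℚᵘ.≃-reflexive (cong (λ z → ℚᵘ.mkℚᵘ z 0) (ℤ.pos-* a b)))
  (ℚᵘ.≃-sym (ℚᵘ.≃-trans (ℚ.toℚᵘ-homo-* (fromℕ a) (fromℕ b))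
                          (ℚᵘ.*-cong (toℚᵘ-fromℕ a) (toℚᵘ-fromℕ b))))))

reciprocal-suc-* : ∀ d → ((+ 1) / suc d) * fromℕ (suc d) ≡ 1ℚ
reciprocal-suc-* d = ℚ.toℚᵘ-injective
  (ℚᵘ.≃-trans (ℚ.toℚᵘ-homo-* ((+ 1) / suc d) (fromℕ (suc d)))
  (ℚᵘ.≃-trans (ℚᵘ.*-cong (ℚ.toℚᵘ-fromℚᵘ (ℚᵘ.mkℚᵘ (+ 1) d)) (toℚᵘ-fromℕ (suc d)))
              (ℚᵘ.*-inverseˡ (ℚᵘ.mkℚᵘ (+ suc d) 0))))

prodℚ-reciprocals-* : ∀ (f : ℕ → ℕ) xs →
  prodℚ (map (λ i → (+ 1) / suc (f i)) xs) * fromℕ (product (map (λ i → suc (f i)) xs)) ≡ 1ℚ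
prodℚ-reciprocals-* f []       = refl
prodℚ-reciprocals-* f (x ∷ xs) = begin
  (r * R) * fromℕ (suc (f x) · P) ≡⟨ cong ((r * R) *_) (fromℕ-· (suc (f x)) P) ⟩
  (r * R) * (q * fromℕ P)         ≡⟨ interchange r R q (fromℕ P) ⟩
  (r * q) * (R * fromℕ P)         ≡⟨ cong₂ _*_ (reciprocal-suc-* (f x)) (prodℚ-reciprocals-* f xs) ⟩
  1ℚ * 1ℚ                         ≡⟨⟩
  1ℚ                              ∎
  where
  r = (+ 1) / suc (f x)
  q = fromℕ (suc (f x))
  R = prodℚ (map (λ i → (+ 1) / suc (f i)) xs)
  P = product (map (λ i → suc (f i)) xs)

fallingℤ≡falling : ∀ n k → fallingℤ n k ≡ + falling n k
fallingℤ≡falling n k =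
  trans (cong prodℤ (map-upTo (λ i → + n ℤ.- + i) k)) (go n k _ (λ _ → refl))
  where
  go : ∀ n k (f : ℕ → ℤ) → (∀ i → f i ≡ + n ℤ.- + i) → prodℤ (applyUpTo f k) ≡ + falling n k
  go n       zero    f f≗ = refl
  go zero    (suc k) f f≗ = cong (ℤ._* prodℤ (applyUpTo (f ∘ suc) k)) (f≗ 0)
  go (suc n) (suc k) f f≗ = begin
    f 0 ℤ.* prodℤ (applyUpTo (f ∘ suc) k)
      ≡⟨ cong₂ ℤ._*_ (trans (f≗ 0) (ℤ.+-identityʳ (+ suc n))) (go n k (f ∘ suc) shift) ⟩
    + suc n ℤ.* + falling n k
      ≡⟨ ℤ.pos-* (suc n) (falling n k) ⟨
    + falling (suc n) (suc k) ∎
    where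
    shift : ∀ i → f (suc i) ≡ + n ℤ.- + i
    shift i = trans (f≗ (suc i)) (trans (ℤ.[1+m]⊖[1+n]≡m⊖n n i) (sym (ℤ.[+m]-[+n]≡m⊖n n i)))

invPartialProd-*-denominator : ∀ μ → invPartialProd μ * fromℕ (denominator μ) ≡ 1ℚ
invPartialProd-*-denominator μ =
  prodℚ-reciprocals-* (λ i → i + sum (take (suc i) μ)) (upTo (length μ))

H≡falling/denominator : ∀ h → (∀ k → 1 ≤ k → h k ≡ k) → ∀ μ n →
  (+ H h μ n) / 1 ≡ ((fallingℤ n (sum μ + length μ)) / 1) * invPartialProd μ
H≡falling/denominator h h≡id μ n = sym (begin
  (fallingℤ n K / 1) * I    ≡⟨ cong (λ z → (z / 1) * I) (fallingℤ≡falling n K) ⟩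
  fromℕ (falling n K) * I   ≡⟨ cong (λ z → fromℕ z * I) (H·denominator≡falling h h≡id μ n) ⟨
  fromℕ (Hμ · D) * I        ≡⟨ cong (_* I) (fromℕ-· Hμ D) ⟩
  (fromℕ Hμ * fromℕ D) * I  ≡⟨ ℚ.*-assoc (fromℕ Hμ) (fromℕ D) I ⟩
  fromℕ Hμ * (fromℕ D * I)  ≡⟨ cong (fromℕ Hμ *_) (ℚ.*-comm (fromℕ D) I) ⟩
  fromℕ Hμ * (I * fromℕ D)  ≡⟨ cong (fromℕ Hμ *_) (invPartialProd-*-denominator μ) ⟩
  fromℕ Hμ * 1ℚ             ≡⟨ ℚ.*-identityʳ (fromℕ Hμ) ⟩
  fromℕ Hμ                  ∎)
  where
  K = sum μ + length μ
  Hμ = H h μ n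
  D = denominator μ
  I = invPartialProd μ

mainTheorem5 : (n : ℕ) → 1 ≤ n → (μ : List ℕ) → All (λ x → 0 < x) μ →
    ((h : ℕ → ℕ) → ((k : ℕ) → 1 ≤ k → h k ≡ 1) →
       H h μ n ≡ (n ∸ sum μ) C length μ)
    × ((h : ℕ → ℕ) → ((k : ℕ) → 1 ≤ k → h k ≡ k) →
       (+ H h μ n) / 1 ≡ ((fallingℤ n (sum μ + length μ)) / 1) * invPartialProd μ)
mainTheorem5 n _ μ _ =
  (λ h h≡1 → H≡binomial h h≡1 μ n) , (λ h h≡id → H≡falling/denominator h h≡id μ n)
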